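{- Let $\mathrm{sort}$ be a sort function satisfying the extended characteristic property. Let $T$ be a type with decidable equality and $\leq$ a total preorder on $T$. For every $s : \mathrm{list}\,T$ and all $x, y : T$, if $x \leq y$ and $x$ and $y$ occur in order in $s$, then $x$ and $y$ occur in order in $\mathrm{sort}_\leq\,s$.
   Context: A total preorder is a relation that is transitive and total. "$x$ and $y$ occur in order in $s$" means: $y$ is an element of the list obtained from $s$ by dropping the elements strictly before the first occurrence of $x$ (so $x$ occurs in $s$ and $y$ occurs at or after its first occurrence; in particular this holds for $y = x$ when $x$ occurs in $s$). Lists: $[]$ empty, $x :: s$ cons, $[x]$ singleton, $\mathbin{+\!\!+}$ concatenation, $\mathrm{rev}$ list reversal. A "relation" $\leq$ on a type $T$ is a function $T \to T \to \mathrm{bool}$. Merge: $[] \mathbin{\land\hspace{ -.45em}\land}_\leq ys = ys$, $xs \mathbin{\land\hspace{ -.45em}\land}_\leq [] = xs$, $(x :: xs) \mathbin{\land\hspace{ -.45em}\land}_\leq (y :: ys) = x :: (xs \mathbin{\land\hspace{ -.45em}\land}_\leq (y :: ys))$ if $x \leq y$, else $y :: ((x :: xs) \mathbin{\land\hspace{ -.45em}\land}_\leq ys)$. Define $xs \mathbin{\lor\hspace{ -.45em}\lor}_\leq ys := \mathrm{rev}\,(\mathrm{rev}\,ys \mathbin{\land\hspace{ -.45em}\land}_\geq \mathrm{rev}\,xs)$ where $\geq$ is the converse of $\leq$. A sort function assigns to every type $T$ and relation $\leq$ on $T$ a function $\mathrm{sort}_\leq : \mathrm{list}\,T \to \mathrm{list}\,T$.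 It satisfies the extended characteristic property if there is a polymorphic $\mathrm{asort}$ of type $\forall (T\,R:\mathcal{U}), (T\to T\to\mathrm{bool}) \to (R\to R\to R)\to(R\to R\to R)\to(T\to R)\to R\to\mathrm{list}\,T\to R$ such that (1) $\mathrm{asort}\,(\leq)\,(\mathbin{\land\hspace{ -.45em}\land}_\leq)\,(\mathbin{\lor\hspace{ -.45em}\lor}_\leq)\,(\lambda x.[x])\,[]\,xs = \mathrm{sort}_\leq\,xs$ for all $T,\leq,xs$; (2) $\mathrm{asort}\,(\leq)\,(\mathbin{+\!\!+})\,(\mathbin{+\!\!+})\,(\lambda x.[x])\,[]\,xs = xs$ for all $T,\leq,xs$; (3) $\mathrm{asort}$ is relationally parametric: for all types $T_1,T_2$, relation $\sim_T\subseteq T_1\times T_2$, types $R_1,R_2$, relation $\sim_R\subseteq R_1\times R_2$, all $\leq_i : T_i\to T_i\to\mathrm{bool}$ with $x_1\sim_T x_2\wedge y_1\sim_T y_2 \Rightarrow (x_1\leq_1 y_1)=(x_2\leq_2 y_2)$, all $m_i, m'_i : R_i\to R_i\to R_i$ each pair preserving $\sim_R$ (i.e. $a_1\sim_R a_2\wedge b_1\sim_R b_2\Rightarrow m_1 a_1 b_1 \sim_R m_2 a_2 b_2$, and likewise for $m'$), all $s_i:T_i\to R_i$ with $x_1\sim_T x_2\Rightarrow s_1x_1\sim_R s_2x_2$, all $e_i : R_i$ with $e_1\sim_R e_2$, and all equal-length pointwise $\sim_T$-related lists $xs_1, xs_2$: $\mathrm{asort}\,(\leq_1)\,m_1\,m'_1\,s_1\,e_1\,xs_1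 \sim_R \mathrm{asort}\,(\leq_2)\,m_2\,m'_2\,s_2\,e_2\,xs_2$. -}

module Defs where

open import Data.Bool using (Bool; true; false; if_then_else_)
open import Data.List using (List; []; _∷_; [_]; _++_; reverse)
open import Data.List.Membership.Propositional using (_∈_)
open import Data.List.Relation.Binary.Pointwise using (Pointwise)
open import Data.Product using (Σ; _×_)
open import Data.Sum using (_⊎_)
open import Relation.Binary.PropositionalEquality using (_≡_)
open import Relation.Binary.Definitions using (DecidableEquality)
open import Relation.Nullary using (yes; no)

Rel : Set → Set
Rel T = T → T → Bool

IsTotalPreorder : {T : Set} → Rel T → Set
IsTotalPreorder {T} le =
  ((x y z : T) → le x y ≡ true → le y z ≡ true → le x z ≡ true)
  × ((x y : T) → le x y ≡ true ⊎ le y x ≡ true)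

converse : {T : Set} → Rel T → Rel T
converse le x y = le y x

merge : {T : Set} → Rel T → List T → List T → List T
merge le [] ys = ys
merge {T} le (x ∷ xs) ys = go ys
  where
  go : List T → List T
  go [] = x ∷ xs
  go (y ∷ ys') = if le x y then x ∷ merge le xs (y ∷ ys') else y ∷ go ys'

mergeRev : {T : Set} → Rel T → List T → List T → List T
mergeRev le xs ys = reverse (merge (converse le) (reverse ys) (reverse xs))

dropBefore : {T : Set} → DecidableEquality T → T → List T → List T
dropBefore _≟_ x [] = []
dropBefore _≟_ x (z ∷ s) with z ≟ x
... | yes _ = z ∷ s
... | no _ = dropBefore _≟_ x s

InOrder : {T : Set} → DecidableEquality T → T → T → List T → Set
InOrder _≟_ x y s = y ∈ dropBefore _≟_ x s

SortFun : Set₁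
SortFun = {T : Set} → Rel T → List T → List T

ASortType : Set₁
ASortType = (T R : Set) → Rel T → (R → R → R) → (R → R → R) → (T → R) → R → List T → R

Parametric : ASortType → Set₁
Parametric asort =
  (T₁ T₂ : Set) (_~T_ : T₁ → T₂ → Set) (R₁ R₂ : Set) (_~R_ : R₁ → R₂ → Set)
  (le₁ : Rel T₁) (le₂ : Rel T₂) →
  (∀ {x₁ x₂ y₁ y₂} → x₁ ~T x₂ → y₁ ~T y₂ → le₁ x₁ y₁ ≡ le₂ x₂ y₂) →
  (m₁ m₁' : R₁ → R₁ → R₁) (m₂ m₂' : R₂ → R₂ → R₂) →
  (∀ {a₁ a₂ b₁ b₂} → a₁ ~R a₂ → b₁ ~R b₂ → m₁ a₁ b₁ ~R m₂ a₂ b₂) →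
  (∀ {a₁ a₂ b₁ b₂} → a₁ ~R a₂ → b₁ ~R b₂ → m₁' a₁ b₁ ~R m₂' a₂ b₂) →
  (s₁ : T₁ → R₁) (s₂ : T₂ → R₂) →
  (∀ {x₁ x₂} → x₁ ~T x₂ → s₁ x₁ ~R s₂ x₂) →
  (e₁ : R₁) (e₂ : R₂) → e₁ ~R e₂ →
  (xs₁ : List T₁) (xs₂ : List T₂) → Pointwise _~T_ xs₁ xs₂ →
  asort T₁ R₁ le₁ m₁ m₁' s₁ e₁ xs₁ ~R asort T₂ R₂ le₂ m₂ m₂' s₂ e₂ xs₂

ExtendedCharacteristic : SortFun → Set₁
ExtendedCharacteristic sort = Σ ASortType λ asort →
  ((T : Set) (le : Rel T) (xs : List T) →
     asort T (List T) le (merge le) (mergeRev le) [_] [] xs ≡ sort le xs)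
  × ((T : Set) (le : Rel T) (xs : List T) →
     asort T (List T) le _++_ _++_ [_] [] xs ≡ xs)
  × Parametric asort

{-# OPTIONS --safe #-}
module Submission where

open import Defs
open import Data.Bool using (Bool; true; false; T; T?)
open import Data.Bool.Properties using (not-¬) renaming (_≟_ to _≟ᵇ_)
open import Data.List using (List; []; _∷_; [_]; _++_; reverse; filter; filterᵇ)
open import Data.List.Properties using (filter-++; filter-accept; filter-none; ++-assoc; ++-identityʳ; unfold-reverse; reverse-++; reverse-involutive)
open import Data.List.Membership.Propositional using (_∈_)
open import Data.List.Membership.Propositional.Properties using (∈-filter⁺; ∈-filter⁻)
open import Data.List.Relation.Unary.All as All using (All; []; _∷_)
open import Data.List.Relation.Unary.AllPairs using (AllPairs; []; _∷_)
open import Data.List.Relation.Unary.Any using (here; there)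
open import Data.List.Relation.Unary.Any.Properties using (reverse⁻)
open import Data.List.Relation.Binary.Pointwise as Pointwise using ()
import Data.List.Relation.Unary.AllPairs.Properties as AllPairs
open import Data.Product using (_,_; proj₁; proj₂)
open import Data.Sum using (inj₁; inj₂; reduce)
open import Function using (_∘_; flip)
open import Level using (Level)
open import Relation.Nullary using (yes; no; ¬_; contradiction)
open import Relation.Nullary.Decidable using (⌊_⌋; _×-dec_; toWitness; fromWitness)
open import Relation.Unary using (Pred; Decidable)
open import Relation.Binary.PropositionalEquality using (_≡_; refl; sym; cong; cong₂; subst; subst₂; module ≡-Reasoning)
open import Relation.Binary.Definitions using (DecidableEquality)

-- By parametricity, asort with merge/mergeRev and asort with ++ are related by "out is sorted,
-- and restricting out and inp to any ≤-clique gives the same list", because merge and mergeRev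
-- preserve this relation towards ++: restricting a merge of sorted lists to a clique gives the
-- restriction of the first list followed by that of the second, and mergeRev is merge for ≥
-- conjugated by reversal. Hence sort≤ s is a stable sort of s. If y ≤ x, then x and y are
-- equivalent and stability keeps their class in order; otherwise y < x, and sortedness puts
-- every y after the first x.

private
  variable
    ℓ : Level

∈-resp-filter≡ : {A : Set} {P : Pred A ℓ} (P? : Decidable P) {xs ys : List A} {z : A} →
  P z → filter P? xs ≡ filter P? ys → z ∈ xs → z ∈ ys
∈-resp-filter≡ P? pz eq z∈xs = proj₁ (∈-filter⁻ P? (subst (_ ∈_) eq (∈-filter⁺ P? z∈xs pz)))

filter-reverse : {A : Set} {P : Pred A ℓ} (P? : Decidable P) (xs : List A) →
  filter P? (reverse xs) ≡ reverse (filter P? xs)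
filter-reverse P? [] = refl
filter-reverse P? (x ∷ xs) = begin
  filter P? (reverse (x ∷ xs))              ≡⟨ cong (filter P?) (unfold-reverse x xs) ⟩
  filter P? (reverse xs ++ [ x ])           ≡⟨ filter-++ P? (reverse xs) [ x ] ⟩
  filter P? (reverse xs) ++ filter P? [ x ] ≡⟨ cong (_++ filter P? [ x ]) (filter-reverse P? xs) ⟩
  reverse (filter P? xs) ++ filter P? [ x ] ≡⟨ snoc-filter ⟩
  reverse (filter P? (x ∷ xs))              ∎
  where
  open ≡-Reasoning
  snoc-filter : reverse (filter P? xs) ++ filter P? [ x ] ≡ reverse (filter P? (x ∷ xs))
  snoc-filter with P? x
  ... | yes _ = sym (unfold-reverse x (filter P? xs))
  ... | no _ = ++-identityʳ _

Sorted : {A : Set} → Rel A → List A → Set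
Sorted le = AllPairs (λ a b → le a b ≡ true)

All-reverse : {A : Set} {P : Pred A ℓ} {xs : List A} → All P xs → All P (reverse xs)
All-reverse pxs = All.tabulate (All.lookup pxs ∘ reverse⁻)

AllPairs-reverse : {A : Set} {R : A → A → Set ℓ} {xs : List A} →
  AllPairs R xs → AllPairs (flip R) (reverse xs)
AllPairs-reverse [] = []
AllPairs-reverse {R = R} {x ∷ xs} (Rxxs ∷ Rxs) =
  subst (AllPairs (flip R)) (sym (unfold-reverse x xs))
    (AllPairs.++⁺ (AllPairs-reverse Rxs) ([] ∷ []) (All.map (_∷ []) (All-reverse Rxxs)))

module _ {A : Set} (_≟_ : DecidableEquality A) where

  ∈-dropBefore⁻ : {x y : A} (s : List A) → y ∈ dropBefore _≟_ x s → y ∈ s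
  ∈-dropBefore⁻ {x} (z ∷ s) y∈ with z ≟ x
  ... | yes _ = y∈
  ... | no _ = there (∈-dropBefore⁻ s y∈)

  InOrder⇒∈ˡ : {x y : A} (s : List A) → InOrder _≟_ x y s → x ∈ s
  InOrder⇒∈ˡ {x} (z ∷ s) x⋯y with z ≟ x
  ... | yes z≡x = here (sym z≡x)
  ... | no _ = there (InOrder⇒∈ˡ s x⋯y)

  dropBefore-filter : {P : Pred A ℓ} (P? : Decidable P) {x : A} → P x → (s : List A) →
    dropBefore _≟_ x (filter P? s) ≡ filter P? (dropBefore _≟_ x s)
  dropBefore-filter P? px [] = refl
  dropBefore-filter P? {x} px (z ∷ s) with P? z
  ... | yes pz with z ≟ x
  ...   | yes _ = sym (filter-accept P? pz)
  ...   | no _ = dropBefore-filter P? px s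
  dropBefore-filter P? {x} px (z ∷ s) | no ¬pz with z ≟ x
  ...   | yes refl = contradiction px ¬pz
  ...   | no _ = dropBefore-filter P? px s

  InOrder-resp-filter≡ : {P : Pred A ℓ} (P? : Decidable P) {x y : A} {s t : List A} →
    P x → P y → filter P? s ≡ filter P? t → InOrder _≟_ x y s → InOrder _≟_ x y t
  InOrder-resp-filter≡ P? {x} {s = s} {t} px py eq = ∈-resp-filter≡ P? py (begin
    filter P? (dropBefore _≟_ x s)  ≡⟨ dropBefore-filter P? px s ⟨
    dropBefore _≟_ x (filter P? s)  ≡⟨ cong (dropBefore _≟_ x) eq ⟩
    dropBefore _≟_ x (filter P? t)  ≡⟨ dropBefore-filter P? px t ⟩
    filter P? (dropBefore _≟_ x t)  ∎)
    where open ≡-Reasoning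

  sorted⇒InOrder : {le : Rel A} {x y : A} {s : List A} →
    Sorted le s → x ∈ s → y ∈ s → ¬ (le y x ≡ true) → InOrder _≟_ x y s
  sorted⇒InOrder {x = x} {s = z ∷ s} (z≤s ∷ sorted) x∈ y∈ y≰x with z ≟ x
  ... | yes _ = y∈
  ... | no z≢x with x∈ | y∈
  ...   | here x≡z   | _          = contradiction (sym x≡z) z≢x
  ...   | there x∈s  | here refl  = contradiction (All.lookup z≤s x∈s) y≰x
  ...   | there x∈s  | there y∈s  = sorted⇒InOrder sorted x∈s y∈s y≰x

Clique : {A : Set} → Rel A → Pred A ℓ → Set ℓ
Clique le P = ∀ {a b} → P a → P b → le a b ≡ true

All-merge : {A : Set} (le : Rel A) {P : Pred A ℓ} {xs ys : List A} →
  All P xs → All P ys → All P (merge le xs ys)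
All-merge le [] pys = pys
All-merge {A = A} le {P = P} {x ∷ xs} (px ∷ pxs) = go
  where
  go : {ys : List A} → All P ys → All P (merge le (x ∷ xs) ys)
  go [] = px ∷ pxs
  go {y ∷ ys} (py ∷ pys) with le x y
  ... | true = px ∷ All-merge le pxs (py ∷ pys)
  ... | false = py ∷ go pys

converse-isTotalPreorder : {A : Set} {le : Rel A} → IsTotalPreorder le → IsTotalPreorder (converse le)
converse-isTotalPreorder (trans , total) = (λ x y z x≥y y≥z → trans z y x y≥z x≥y) , (λ x y → total y x)

module _ {A : Set} {le : Rel A} (tp : IsTotalPreorder le) where

  private
    ≤-trans : {a b c : A} → le a b ≡ true → le b c ≡ true → le a c ≡ true
    ≤-trans = proj₁ tp _ _ _

    ≰⇒≥ : {a b : A} → le a b ≡ false → le b a ≡ true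
    ≰⇒≥ {a} {b} a≰b with proj₂ tp a b
    ... | inj₁ a≤b = contradiction a≤b (not-¬ a≰b)
    ... | inj₂ b≤a = b≤a

  ≤-refl : (a : A) → le a a ≡ true
  ≤-refl a = reduce (proj₂ tp a a)

  merge-sorted : {xs ys : List A} → Sorted le xs → Sorted le ys → Sorted le (merge le xs ys)
  merge-sorted [] sys = sys
  merge-sorted {x ∷ xs} (x≤xs ∷ sxs) = go
    where
    go : {ys : List A} → Sorted le ys → Sorted le (merge le (x ∷ xs) ys)
    go [] = x≤xs ∷ sxs
    go {y ∷ ys} (y≤ys ∷ sys) with le x y in x≤ᵇy
    ... | true = All-merge le x≤xs (x≤ᵇy ∷ All.map (≤-trans x≤ᵇy) y≤ys) ∷ merge-sorted sxs (y≤ys ∷ sys)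
    ... | false = All-merge le (≰⇒≥ x≤ᵇy ∷ All.map (≤-trans (≰⇒≥ x≤ᵇy)) x≤xs) y≤ys ∷ go sys

  filter-merge : {P : Pred A ℓ} (P? : Decidable P) → Clique le P → {xs ys : List A} →
    Sorted le xs → Sorted le ys → filter P? (merge le xs ys) ≡ filter P? xs ++ filter P? ys
  filter-merge P? clique [] sys = refl
  filter-merge {P = P} P? clique {x ∷ xs} (x≤xs ∷ sxs) = go
    where
    open ≡-Reasoning

    keep : List A → List A
    keep = filter P?

    go : {ys : List A} → Sorted le ys → keep (merge le (x ∷ xs) ys) ≡ keep (x ∷ xs) ++ keep ys
    go [] = sym (++-identityʳ _)
    go {y ∷ ys} (y≤ys ∷ sys) with le x y in x≤ᵇy
    ... | true = begin
      keep ([ x ] ++ merge le xs (y ∷ ys))          ≡⟨ filter-++ P? [ x ] _ ⟩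
      keep [ x ] ++ keep (merge le xs (y ∷ ys))     ≡⟨ cong (keep [ x ] ++_) (filter-merge P? clique sxs (y≤ys ∷ sys)) ⟩
      keep [ x ] ++ (keep xs ++ keep (y ∷ ys))      ≡⟨ ++-assoc (keep [ x ]) _ _ ⟨
      (keep [ x ] ++ keep xs) ++ keep (y ∷ ys)      ≡⟨ cong (_++ keep (y ∷ ys)) (filter-++ P? [ x ] xs) ⟨
      keep (x ∷ xs) ++ keep (y ∷ ys)                ∎
    ... | false = begin
      keep ([ y ] ++ merge le (x ∷ xs) ys)          ≡⟨ filter-++ P? [ y ] _ ⟩
      keep [ y ] ++ keep (merge le (x ∷ xs) ys)     ≡⟨ cong (keep [ y ] ++_) (go sys) ⟩
      keep [ y ] ++ (keep (x ∷ xs) ++ keep ys)      ≡⟨ ++-assoc (keep [ y ]) _ _ ⟨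
      (keep [ y ] ++ keep (x ∷ xs)) ++ keep ys      ≡⟨ cong (_++ keep ys) y-commutes ⟩
      (keep (x ∷ xs) ++ keep [ y ]) ++ keep ys      ≡⟨ ++-assoc (keep (x ∷ xs)) _ _ ⟩
      keep (x ∷ xs) ++ (keep [ y ] ++ keep ys)      ≡⟨ cong (keep (x ∷ xs) ++_) (filter-++ P? [ y ] ys) ⟨
      keep (x ∷ xs) ++ keep (y ∷ ys)                ∎
      where
      -- y < x ≤ every element of x ∷ xs, so a clique containing y misses all of x ∷ xs.
      xs-excluded : P y → All (¬_ ∘ P) (x ∷ xs)
      xs-excluded py = (λ px → not-¬ x≤ᵇy (clique px py))
                     ∷ All.map (λ x≤z pz → not-¬ x≤ᵇy (≤-trans x≤z (clique pz py))) x≤xs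

      y-commutes : keep [ y ] ++ keep (x ∷ xs) ≡ keep (x ∷ xs) ++ keep [ y ]
      y-commutes with P? y
      ... | no _ = sym (++-identityʳ _)
      ... | yes py rewrite filter-none P? (xs-excluded py) = refl

-- The predicates are Bool-valued so that the relation stays in Set, as the parametricity of asort demands.
record IsStableSortOf {A : Set} (le : Rel A) (out inp : List A) : Set where
  field
    sorted : Sorted le out
    stable : (p : A → Bool) → Clique le (T ∘ p) → filterᵇ p out ≡ filterᵇ p inp

open IsStableSortOf

isStableSortOf-[] : {A : Set} {le : Rel A} → IsStableSortOf le [] []
isStableSortOf-[] = record { sorted = [] ; stable = λ _ _ → refl }

isStableSortOf-[_] : {A : Set} {le : Rel A} (x : A) → IsStableSortOf le [ x ] [ x ]
isStableSortOf-[ x ] = record { sorted = [] ∷ [] ; stable = λ _ _ → refl }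

isStableSortOf-merge : {A : Set} {le : Rel A} → IsTotalPreorder le → {a a′ b b′ : List A} →
  IsStableSortOf le a a′ → IsStableSortOf le b b′ → IsStableSortOf le (merge le a b) (a′ ++ b′)
isStableSortOf-merge {le = le} tp {a} {a′} {b} {b′} sa sb = record
  { sorted = merge-sorted tp (sorted sa) (sorted sb)
  ; stable = λ p clique → begin
      filterᵇ p (merge le a b)      ≡⟨ filter-merge tp (T? ∘ p) clique (sorted sa) (sorted sb) ⟩
      filterᵇ p a ++ filterᵇ p b    ≡⟨ cong₂ _++_ (stable sa p clique) (stable sb p clique) ⟩
      filterᵇ p a′ ++ filterᵇ p b′  ≡⟨ filter-++ (T? ∘ p) a′ b′ ⟨
      filterᵇ p (a′ ++ b′)          ∎
  }
  where open ≡-Reasoning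

isStableSortOf-reverse : {A : Set} {le : Rel A} {a a′ : List A} →
  IsStableSortOf le a a′ → IsStableSortOf (converse le) (reverse a) (reverse a′)
isStableSortOf-reverse {a = a} {a′} sa = record
  { sorted = AllPairs-reverse (sorted sa)
  ; stable = λ p clique → begin
      filterᵇ p (reverse a)    ≡⟨ filter-reverse (T? ∘ p) a ⟩
      reverse (filterᵇ p a)    ≡⟨ cong reverse (stable sa p (λ pa pb → clique pb pa)) ⟩
      reverse (filterᵇ p a′)   ≡⟨ filter-reverse (T? ∘ p) a′ ⟨
      filterᵇ p (reverse a′)   ∎
  }
  where open ≡-Reasoning

isStableSortOf-mergeRev : {A : Set} {le : Rel A} → IsTotalPreorder le → {a a′ b b′ : List A} →
  IsStableSortOf le a a′ → IsStableSortOf le b b′ → IsStableSortOf le (mergeRev le a b) (a′ ++ b′)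
isStableSortOf-mergeRev {le = le} tp {a} {a′} {b} {b′} sa sb =
  subst (IsStableSortOf le (mergeRev le a b)) reverse-reverse-++
    (isStableSortOf-reverse (isStableSortOf-merge (converse-isTotalPreorder tp)
      (isStableSortOf-reverse sb) (isStableSortOf-reverse sa)))
  where
  open ≡-Reasoning
  reverse-reverse-++ : reverse (reverse b′ ++ reverse a′) ≡ a′ ++ b′
  reverse-reverse-++ = begin
    reverse (reverse b′ ++ reverse a′)          ≡⟨ reverse-++ (reverse b′) (reverse a′) ⟩
    reverse (reverse a′) ++ reverse (reverse b′) ≡⟨ cong₂ _++_ (reverse-involutive a′) (reverse-involutive b′) ⟩
    a′ ++ b′                                    ∎

isStableSortOf-sort : (sort : SortFun) → ExtendedCharacteristic sort →
  {A : Set} {le : Rel A} → IsTotalPreorder le → (s : List A) → IsStableSortOf le (sort le s) s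
isStableSortOf-sort sort (asort , asort≡sort , asort≡id , parametric) {A} {le} tp s =
  subst₂ (IsStableSortOf le) (asort≡sort A le s) (asort≡id A le s)
    (parametric A A _≡_ (List A) (List A) (IsStableSortOf le) le le (λ { refl refl → refl })
      (merge le) (mergeRev le) _++_ _++_ (isStableSortOf-merge tp) (isStableSortOf-mergeRev tp)
      [_] [_] (λ { {x} refl → isStableSortOf-[ x ] }) [] [] isStableSortOf-[]
      s s (Pointwise.refl refl))

equivalentᵇ : {A : Set} → Rel A → A → A → Bool
equivalentᵇ le x z = ⌊ (le x z ≟ᵇ true) ×-dec (le z x ≟ᵇ true) ⌋

module _ {A : Set} {le : Rel A} (tp : IsTotalPreorder le) where

  equivalentᵇ-clique : (x : A) → Clique le (T ∘ equivalentᵇ le x)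
  equivalentᵇ-clique x {a} {b} xa xb =
    proj₁ tp a x b (proj₂ (toWitness xa)) (proj₁ (toWitness xb))

  equivalentᵇ-refl : (x : A) → T (equivalentᵇ le x x)
  equivalentᵇ-refl x = fromWitness (≤-refl tp x , ≤-refl tp x)

  isStableSortOf-∈ : {out inp : List A} {z : A} → IsStableSortOf le out inp → z ∈ inp → z ∈ out
  isStableSortOf-∈ {z = z} st =
    ∈-resp-filter≡ (T? ∘ equivalentᵇ le z) (equivalentᵇ-refl z)
      (sym (stable st (equivalentᵇ le z) (equivalentᵇ-clique z)))

  isStableSortOf-InOrder : (_≟_ : DecidableEquality A) {out inp : List A} {x y : A} →
    IsStableSortOf le out inp → le x y ≡ true → InOrder _≟_ x y inp → InOrder _≟_ x y out
  isStableSortOf-InOrder _≟_ {out} {inp} {x} {y} st x≤y x⋯y with le y x ≟ᵇ true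
  ... | yes y≤x =
    InOrder-resp-filter≡ _≟_ (T? ∘ equivalentᵇ le x) {s = inp} {out}
      (equivalentᵇ-refl x) (fromWitness (x≤y , y≤x))
      (sym (stable st (equivalentᵇ le x) (equivalentᵇ-clique x))) x⋯y
  ... | no y≰x =
    sorted⇒InOrder _≟_ (sorted st)
      (isStableSortOf-∈ st (InOrder⇒∈ˡ _≟_ inp x⋯y))
      (isStableSortOf-∈ st (∈-dropBefore⁻ _≟_ inp x⋯y)) y≰x

lemmaB26 : (sort : SortFun) → ExtendedCharacteristic sort →
    (T : Set) (_≟_ : DecidableEquality T) (le : Rel T) → IsTotalPreorder le →
    (s : List T) (x y : T) → le x y ≡ true →
    InOrder _≟_ x y s → InOrder _≟_ x y (sort le s)
lemmaB26 sort characteristic A _≟_ le tp s x y =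
  isStableSortOf-InOrder tp _≟_ (isStableSortOf-sort sort characteristic tp s)
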